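{- Let $(G_x,\mathrm{lab}_x)=(G_{y_1},\mathrm{lab}_{y_1})\oplus(G_{y_2},\mathrm{lab}_{y_2})$ where $G_{y_1}$ and $G_{y_2}$ are vertex-disjoint non-empty graphs. For $a\in\{1,2\}$ let $\mathcal{A}_{y_a}\subseteq\mathrm{aux}(G_{y_a},\mathrm{lab}_{y_a})$ satisfy $\mathcal{A}_{y_a}\lesssim\mathrm{aux}(G_{y_a},\mathrm{lab}_{y_a})$. Define $\mathcal{A}_x=\{A_1\uplus A_2 : A_1\in\mathcal{A}_{y_1},A_2\in\mathcal{A}_{y_2}\}$. Then $\mathcal{A}_x\subseteq\mathrm{aux}(G_x,\mathrm{lab}_x)$ and $\mathcal{A}_x\lesssim\mathrm{aux}(G_x,\mathrm{lab}_x)$.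
   Context: A multi-$k$-labeled graph is $(H,\mathrm{lab})$ with $\mathrm{lab}:V(H)\to2^{[k]}$; $\oplus$ is the disjoint union preserving labels. A path packing of $H$ is a set of vertex-disjoint paths (possibly of length 0) in $H$ covering all vertices. A label choice of a path packing $\mathcal{P}$ is a map $\phi:\mathcal{P}\to\binom{[k]}{1}\cup\binom{[k]}{2}$ such that for each path $P$ with endpoints $u,v$ ($u=v$ iff $P$ has length 0), writing $\phi(P)=\{a,b\}$ (possibly $a=b$), we have $a\in\mathrm{lab}(u),b\in\mathrm{lab}(v)$ or $a\in\mathrm{lab}(v),b\in\mathrm{lab}(u)$. Multigraphs here have vertex set $[k]$, may have loops and parallel edges; two multigraphs are equal if every pair $\{a,b\}$ (including $a=b$) has the same multiplicity. $\mathrm{aux}(\mathcal{P},\phi)$ is the red multigraph in which $\{a,b\}$ has multiplicity $|\phi^{ -1}(\{a,b\})|$, and $\mathrm{aux}(H,\mathrm{lab})$ is the set of all $\mathrm{aux}(\mathcal{P},\phi)$. $A\uplus B$ is the edge-disjoint union (multiplicities add). For a multigraph with red and blue edges and at least one edge, a red-blue Eulerian trail is a closed walk traversing every edge exactly once with alternating colors (first and last edges of different colors). For families $\mathcal{A},\mathcal{B}$ of red multigraphs, $\mathcal{A}\lesssim\mathcal{B}$ means: for every blue multigraph $M$ on $[k]$, if some $B\in\mathcal{B}$ makes $B\uplus M$ admit a red-blue Eulerian trail, then some $A\in\mathcal{A}$ makes $A\uplus M$ admit one. -}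

module Defs where

open import Data.Nat using (ℕ; zero; suc; _+_)
open import Data.Bool using (Bool; true; false; _∧_; _∨_; if_then_else_)
open import Data.Bool.Properties using (∨-comm)
open import Data.Fin using (Fin; zero; suc; splitAt; _≟_)
open import Data.Sum using (_⊎_; inj₁; inj₂; [_,_]′)
open import Data.Product using (Σ; Σ-syntax; ∃; ∃-syntax; _×_; _,_; proj₁; proj₂)
open import Data.List using (List; []; _∷_; concatMap)
open import Data.List.NonEmpty using (List⁺; _∷_; head; last; toList)
open import Data.List.Relation.Unary.All using (All; []; _∷_)
open import Data.Maybe using (Maybe; just; nothing; maybe)
open import Data.Unit using (⊤)
open import Function using (id)
open import Relation.Nullary using (¬_)
open import Relation.Nullary.Decidable using (⌊_⌋)
open import Relation.Binary.PropositionalEquality using (_≡_; _≢_; refl; cong; cong₂; trans)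

-- Finite simple graphs with multi-k-labels (lab v ⊆ [k] as Fin k → Bool)

record LGraph (k : ℕ) : Set where
  field
    n       : ℕ
    adj     : Fin n → Fin n → Bool
    adj-sym : ∀ u v → adj u v ≡ adj v u
    adj-irr : ∀ u → adj u u ≡ false
    lab     : Fin n → Fin k → Bool
open LGraph public

adj⊕ : ∀ {n₁ n₂} → (Fin n₁ → Fin n₁ → Bool) → (Fin n₂ → Fin n₂ → Bool)
     → Fin n₁ ⊎ Fin n₂ → Fin n₁ ⊎ Fin n₂ → Bool
adj⊕ a₁ a₂ (inj₁ u) (inj₁ v) = a₁ u v
adj⊕ a₁ a₂ (inj₂ u) (inj₂ v) = a₂ u v
adj⊕ a₁ a₂ (inj₁ u) (inj₂ v) = false
adj⊕ a₁ a₂ (inj₂ u) (inj₁ v) = false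

adj⊕-sym : ∀ {n₁ n₂} (a₁ : Fin n₁ → Fin n₁ → Bool) (a₂ : Fin n₂ → Fin n₂ → Bool)
  → (∀ u v → a₁ u v ≡ a₁ v u) → (∀ u v → a₂ u v ≡ a₂ v u)
  → ∀ x y → adj⊕ a₁ a₂ x y ≡ adj⊕ a₁ a₂ y x
adj⊕-sym a₁ a₂ s₁ s₂ (inj₁ u) (inj₁ v) = s₁ u v
adj⊕-sym a₁ a₂ s₁ s₂ (inj₂ u) (inj₂ v) = s₂ u v
adj⊕-sym a₁ a₂ s₁ s₂ (inj₁ u) (inj₂ v) = refl
adj⊕-sym a₁ a₂ s₁ s₂ (inj₂ u) (inj₁ v) = refl

adj⊕-irr : ∀ {n₁ n₂} (a₁ : Fin n₁ → Fin n₁ → Bool) (a₂ : Fin n₂ → Fin n₂ → Bool)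
  → (∀ u → a₁ u u ≡ false) → (∀ u → a₂ u u ≡ false)
  → ∀ x → adj⊕ a₁ a₂ x x ≡ false
adj⊕-irr a₁ a₂ i₁ i₂ (inj₁ u) = i₁ u
adj⊕-irr a₁ a₂ i₁ i₂ (inj₂ u) = i₂ u

_⊕_ : ∀ {k} → LGraph k → LGraph k → LGraph k
H₁ ⊕ H₂ = record
  { n       = n H₁ + n H₂
  ; adj     = λ u v → adj⊕ (adj H₁) (adj H₂) (splitAt (n H₁) u) (splitAt (n H₁) v)
  ; adj-sym = λ u v → adj⊕-sym (adj H₁) (adj H₂) (adj-sym H₁) (adj-sym H₂)
                        (splitAt (n H₁) u) (splitAt (n H₁) v)
  ; adj-irr = λ u → adj⊕-irr (adj H₁) (adj H₂) (adj-irr H₁) (adj-irr H₂) (splitAt (n H₁) u)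
  ; lab     = λ u → [ lab H₁ , lab H₂ ]′ (splitAt (n H₁) u)
  }

Linked : ∀ {k} (H : LGraph k) → Fin (n H) → List (Fin (n H)) → Set
Linked H u []       = ⊤
Linked H u (v ∷ vs) = (adj H u v ≡ true) × Linked H v vs

IsPath : ∀ {k} (H : LGraph k) → List⁺ (Fin (n H)) → Set
IsPath H (u ∷ us) = Linked H u us

occ : ∀ {m} → Fin m → List (Fin m) → ℕ
occ v []       = 0
occ v (w ∷ ws) = (if ⌊ v ≟ w ⌋ then 1 else 0) + occ v ws

-- a set of paths (as a list) such that every vertex lies on exactly one
-- path, exactly once (hence vertex-disjoint paths covering all vertices)
record PathPacking {k} (H : LGraph k) : Set where
  field
    paths   : List (List⁺ (Fin (n H)))
    arePath : All (IsPath H) paths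
    cover   : ∀ v → occ v (concatMap toList paths) ≡ 1
open PathPacking public

ValidChoice : ∀ {k} (H : LGraph k) → List⁺ (Fin (n H)) → Fin k × Fin k → Set
ValidChoice H p (a , b) =
  ((lab H (head p) a ≡ true) × (lab H (last p) b ≡ true)) ⊎
  ((lab H (last p) a ≡ true) × (lab H (head p) b ≡ true))

LabelChoice : ∀ {k} (H : LGraph k) → PathPacking H → Set
LabelChoice {k} H 𝒫 = All (λ p → Σ (Fin k × Fin k) (ValidChoice H p)) (paths 𝒫)

-- Multigraphs on [k] (loops, parallel edges): multiplicity of each pair {a,b}

record MG (k : ℕ) : Set where
  field
    mult : Fin k → Fin k → ℕ
    sym  : ∀ a b → mult a b ≡ mult b a
open MG public

_≋_ : ∀ {k} → MG k → MG k → Set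
A ≋ B = ∀ a b → mult A a b ≡ mult B a b

_⊎ᴹ_ : ∀ {k} → MG k → MG k → MG k
A ⊎ᴹ B = record
  { mult = λ a b → mult A a b + mult B a b
  ; sym  = λ a b → cong₂ _+_ (sym A a b) (sym B a b) }

pairIs : ∀ {k} → Fin k × Fin k → Fin k → Fin k → Bool
pairIs (c , d) a b = (⌊ c ≟ a ⌋ ∧ ⌊ d ≟ b ⌋) ∨ (⌊ c ≟ b ⌋ ∧ ⌊ d ≟ a ⌋)

pairIs-sym : ∀ {k} (cd : Fin k × Fin k) a b → pairIs cd a b ≡ pairIs cd b a
pairIs-sym (c , d) a b = ∨-comm (⌊ c ≟ a ⌋ ∧ ⌊ d ≟ b ⌋) (⌊ c ≟ b ⌋ ∧ ⌊ d ≟ a ⌋)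

ind : Bool → ℕ
ind true  = 1
ind false = 0

auxMult : ∀ {k} {A : Set} {P : A → Fin k × Fin k → Set} {xs : List A}
        → All (λ x → Σ (Fin k × Fin k) (P x)) xs → Fin k → Fin k → ℕ
auxMult []              a b = 0
auxMult ((cd , _) ∷ cs) a b = ind (pairIs cd a b) + auxMult cs a b

auxMult-sym : ∀ {k} {A : Set} {P : A → Fin k × Fin k → Set} {xs : List A}
  (cs : All (λ x → Σ (Fin k × Fin k) (P x)) xs) a b → auxMult cs a b ≡ auxMult cs b a
auxMult-sym []              a b = refl
auxMult-sym ((cd , _) ∷ cs) a b =
  cong₂ _+_ (cong ind (pairIs-sym cd a b)) (auxMult-sym cs a b)

auxOf : ∀ {k} (H : LGraph k) (𝒫 : PathPacking H) → LabelChoice H 𝒫 → MG k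
auxOf H 𝒫 φ = record { mult = auxMult φ ; sym = auxMult-sym φ }

InAux : ∀ {k} → LGraph k → MG k → Set
InAux H A = Σ[ 𝒫 ∈ PathPacking H ] Σ[ φ ∈ LabelChoice H 𝒫 ] (auxOf H 𝒫 φ ≋ A)

Family : ℕ → Set₁
Family k = MG k → Set

_⊆ᶠ_ : ∀ {k} → Family k → Family k → Set
𝒜 ⊆ᶠ ℬ = ∀ A → 𝒜 A → ℬ A

inc : ∀ {m} → Fin m → Maybe (Fin m)
inc {suc zero}    zero    = nothing
inc {suc (suc m)} zero    = just (suc zero)
inc {suc (suc m)} (suc i) = Data.Maybe.map suc (inc {suc m} i)
  where import Data.Maybe

next : ∀ {m} → Fin (suc m) → Fin (suc m)
next i = maybe id zero (inc i)

sumFin : ∀ m → (Fin m → ℕ) → ℕ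
sumFin zero    f = 0
sumFin (suc m) f = f zero + sumFin m (λ i → f (suc i))

-- a step of a walk: traverse an edge from s to t of colour c (true = red, false = blue)
record Step (k : ℕ) : Set where
  constructor step
  field
    src tgt : Fin k
    red?    : Bool
open Step public

uses : ∀ {k m} → (Fin m → Step k) → Bool → Fin k → Fin k → ℕ
uses {m = m} t c a b =
  sumFin m (λ i → ind (pairIs (src (t i) , tgt (t i)) a b ∧ ⌊ red? (t i) Data.Bool.≟ c ⌋))
  where import Data.Bool

record RBEulerian {k} (R B : MG k) : Set where
  field
    len     : ℕ
    trail   : Fin (suc len) → Step k
    closed  : ∀ i → tgt (trail i) ≡ src (trail (next i))
    alt     : ∀ i → red? (trail i) ≢ red? (trail (next i))
    useRed  : ∀ a b → uses trail true  a b ≡ mult R a b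
    useBlue : ∀ a b → uses trail false a b ≡ mult B a b

_≲_ : ∀ {k} → Family k → Family k → Set
_≲_ {k} 𝒜 ℬ = ∀ (M : MG k) → (Σ[ B ∈ MG k ] ℬ B × RBEulerian B M)
                            → Σ[ A ∈ MG k ] 𝒜 A × RBEulerian A M

Aux : ∀ {k} → LGraph k → Family k
Aux H = InAux H

Combine : ∀ {k} → Family k → Family k → Family k
Combine {k} 𝒜₁ 𝒜₂ A = Σ[ A₁ ∈ MG k ] Σ[ A₂ ∈ MG k ] 𝒜₁ A₁ × 𝒜₂ A₂ × (A ≋ (A₁ ⊎ᴹ A₂))

module Submission where

-- A path packing of H₁ ⊕ H₂ with a label choice is the same as one of H₁ together with one of
-- H₂, since no path crosses between the two graphs; so aux(H₁ ⊕ H₂) consists of the B₁ ⊎ B₂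
-- with Bᵢ ∈ aux(Hᵢ), which gives the inclusion.  For ≲ it then suffices to replace B₁ by some
-- A₁ ∈ 𝒜₁ in a red-blue Eulerian trail of (B₁ ⊎ B₂) ⊎ M, and afterwards B₂ in the same way.
-- Cut the trail at its B₁-edges (there is one, as H₁ is non-empty): between two consecutive
-- B₁-edges runs an alternating path whose red edges lie in B₂.  Replacing each such segment by
-- a single blue edge joining its ends gives a trail of B₁ ⊎ M′, hence by 𝒜₁ ≲ aux(H₁) a trail
-- of A₁ ⊎ M′ for some A₁ ∈ 𝒜₁.  Substituting the segments back for the blue edges of M′, each
-- traversed in the direction the new trail needs, yields a trail of (A₁ ⊎ B₂) ⊎ M.

open import Defs hiding (sym)
open import Data.Nat using (ℕ; zero; suc; _+_; _<_; _≥_; _⊓_; pred; s≤s; z≤n)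
open import Data.Nat.Properties
  using (+-comm; +-assoc; +-identityʳ; +-cancelˡ-≡; ⊓-zeroʳ; m≤n⇒m⊓n≡m; m≤m+n; +-commutativeSemigroup)
open import Data.Nat.ListAction using (sum)
open import Data.Nat.ListAction.Properties using (sum-++; sum-↭)
open import Data.Bool using (Bool; true; false; _∧_; if_then_else_)
import Data.Bool as Bool
open import Data.Bool.Properties using (∧-comm; ∨-comm; ∧-identityʳ; ∧-zeroʳ; T-∧; T-∨; T-≡)
open import Data.Fin using (Fin; zero; suc; _≟_; inject₁; fromℕ; fromℕ<; _↑ˡ_; _↑ʳ_; splitAt; join)
open import Data.Fin.Properties using (↑ˡ-injective; ↑ʳ-injective; splitAt-↑ˡ; splitAt-↑ʳ; splitAt-join; join-splitAt)
open import Data.Unit using (⊤; tt)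
open import Data.Empty using (⊥-elim)
open import Data.Product using (Σ; ∃; ∃₂; _×_; _,_; proj₁; proj₂; swap)
import Data.Product as Product
open import Data.Sum using (_⊎_; inj₁; inj₂; [_,_]′; reduce)
open import Data.Maybe using (just; nothing)
open import Data.List using (List; []; _∷_; _++_; map; reverse; concatMap; mapMaybe; tabulate; lookup; length; initLast; _∷ʳ′_)
open import Data.List.NonEmpty using (List⁺; _∷_; last)
import Data.List.NonEmpty as List⁺
open import Data.List.Relation.Unary.All using (All; []; _∷_)
import Data.List.Relation.Unary.All.Properties as All
open import Data.List.Properties
  using (map-++; map-cong; map-∘; ++-assoc; ++-identityʳ; unfold-reverse; concatMap-++; concatMap-map; map-concatMap; mapMaybe-++; tabulate-lookup)
open import Data.List.Relation.Binary.Permutation.Propositional using (_↭_; ↭-refl; module PermutationReasoning)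
import Data.List.Relation.Binary.Permutation.Propositional as ↭
open import Data.List.Relation.Binary.Permutation.Propositional.Properties
  using (↭-reverse; ++-comm; shifts; ++⁺ˡ) renaming (map⁺ to ↭-map⁺)
open import Function using (_∘_; id; const; _⇔_; mk⇔; Equivalence)
open import Algebra.Bundles using (CommutativeMonoid)
import Relation.Binary.Reasoning.Setoid as SetoidReasoning
import Algebra.Properties.CommutativeSemigroup as CommutativeSemigroupProperties
open import Relation.Nullary.Decidable using (⌊_⌋; toWitness; fromWitness)
open import Relation.Nullary using (yes; no)
open import Relation.Binary.PropositionalEquality
  using (_≡_; _≢_; refl; sym; trans; cong; cong₂; subst; subst₂; module ≡-Reasoning)

module ℕ+ = CommutativeSemigroupProperties +-commutativeSemigroup

Edge : ℕ → Set
Edge k = Fin k × Fin k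

module _ {A B : Set} where

  lefts : List (A ⊎ B) → List A
  lefts = mapMaybe [ just , const nothing ]′

  rights : List (A ⊎ B) → List B
  rights = mapMaybe [ const nothing , just ]′

inc-inject₁ : ∀ {m} (j : Fin m) → inc {suc m} (inject₁ j) ≡ just (suc j)
inc-inject₁ {suc m} zero    = refl
inc-inject₁ {suc m} (suc j) rewrite inc-inject₁ j = refl

inc-fromℕ : ∀ m → inc {suc m} (fromℕ m) ≡ nothing
inc-fromℕ zero    = refl
inc-fromℕ (suc m) rewrite inc-fromℕ m = refl

next-inject₁ : ∀ {m} (j : Fin m) → next (inject₁ j) ≡ suc j
next-inject₁ j rewrite inc-inject₁ j = refl

next-fromℕ : ∀ m → next (fromℕ m) ≡ zero
next-fromℕ m rewrite inc-fromℕ m = refl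

inject₁-or-fromℕ : ∀ {m} (i : Fin (suc m)) → (∃ λ j → i ≡ inject₁ j) ⊎ i ≡ fromℕ m
inject₁-or-fromℕ {zero}  zero    = inj₂ refl
inject₁-or-fromℕ {suc m} zero    = inj₁ (zero , refl)
inject₁-or-fromℕ {suc m} (suc i) with inject₁-or-fromℕ i
... | inj₁ (j , refl) = inj₁ (suc j , refl)
... | inj₂ refl       = inj₂ refl

module _ {k : ℕ} where

  -- Multigraphs as multisets of edges

  pairIs-refl : ∀ (a b : Fin k) → pairIs (a , b) a b ≡ true
  pairIs-refl a b =
    Equivalence.to T-≡ (Equivalence.from T-∨ (inj₁ (Equivalence.from (T-∧ {⌊ a ≟ a ⌋}) (fromWitness refl , fromWitness refl))))

  pairIs-swap : ∀ (e : Edge k) a b → pairIs (swap e) a b ≡ pairIs e a b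
  pairIs-swap (c , d) a b rewrite ∧-comm ⌊ d ≟ a ⌋ ⌊ c ≟ b ⌋ | ∧-comm ⌊ d ≟ b ⌋ ⌊ c ≟ a ⌋ = ∨-comm (⌊ c ≟ b ⌋ ∧ ⌊ d ≟ a ⌋) _

  pairIs⇒≡ : ∀ {c d a b : Fin k} → pairIs (c , d) a b ≡ true → (c ≡ a × d ≡ b) ⊎ (c ≡ b × d ≡ a)
  pairIs⇒≡ {c} {d} {a} {b} e
    with Equivalence.to (T-∨ {⌊ c ≟ a ⌋ ∧ ⌊ d ≟ b ⌋}) (Equivalence.from T-≡ e)
  ... | inj₁ t = inj₁ (Product.map toWitness toWitness (Equivalence.to (T-∧ {⌊ c ≟ a ⌋}) t))
  ... | inj₂ t = inj₂ (Product.map toWitness toWitness (Equivalence.to (T-∧ {⌊ c ≟ b ⌋}) t))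

  -- ≋ wrapped in a record, so that Agda can infer the two multigraphs from a proof.
  infix 4 _≈_
  record _≈_ (A B : MG k) : Set where
    constructor pointwise
    field at : A ≋ B
  open _≈_ public

  ∅ : MG k
  ∅ = record { mult = λ _ _ → 0 ; sym = λ _ _ → refl }

  ⊎ᴹ-commutativeMonoid : CommutativeMonoid _ _
  ⊎ᴹ-commutativeMonoid = record
    { Carrier = MG k
    ; _≈_ = _≈_
    ; _∙_ = _⊎ᴹ_
    ; ε = ∅
    ; isCommutativeMonoid = record
      { isMonoid = record
        { isSemigroup = record
          { isMagma = record
            { isEquivalence = record
              { refl  = pointwise λ _ _ → refl
              ; sym   = λ A≈B → pointwise λ a b → sym (at A≈B a b)
              ; trans = λ A≈B B≈C → pointwise λ a b → trans (at A≈B a b) (at B≈C a b) }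
            ; ∙-cong = λ A≈ B≈ → pointwise λ a b → cong₂ _+_ (at A≈ a b) (at B≈ a b) }
          ; assoc = λ A B C → pointwise λ a b → +-assoc (mult A a b) _ _ }
        ; identity = (λ _ → pointwise λ _ _ → refl) , λ A → pointwise λ a b → +-identityʳ (mult A a b) }
      ; comm = λ A B → pointwise λ a b → +-comm (mult A a b) _ } }

  open CommutativeMonoid ⊎ᴹ-commutativeMonoid public using ()
    renaming ( refl to ≈-refl; sym to ≈-sym; trans to ≈-trans; setoid to ≈-setoid
             ; ∙-cong to ⊎ᴹ-cong; ∙-congˡ to ⊎ᴹ-congˡ; ∙-congʳ to ⊎ᴹ-congʳ
             ; reflexive to ≈-reflexive; commutativeSemigroup to ⊎ᴹ-commutativeSemigroup
             ; assoc to ⊎ᴹ-assoc; comm to ⊎ᴹ-comm; identityˡ to ⊎ᴹ-identityˡ; identityʳ to ⊎ᴹ-identityʳ)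

  module ⊎ᴹ-Properties = CommutativeSemigroupProperties ⊎ᴹ-commutativeSemigroup

  ⊎ᴹ-cancelˡ : ∀ A {B C : MG k} → A ⊎ᴹ B ≈ A ⊎ᴹ C → B ≈ C
  ⊎ᴹ-cancelˡ A eq = pointwise λ a b → +-cancelˡ-≡ (mult A a b) _ _ (at eq a b)

  Nonempty : MG k → Set
  Nonempty A = ∃₂ λ a b → 0 < mult A a b

  Nonempty-resp : ∀ {A B} → A ≈ B → Nonempty A → Nonempty B
  Nonempty-resp A≈B (a , b , pos) = a , b , subst (0 <_) (at A≈B a b) pos

  multOf : List (Edge k) → Fin k → Fin k → ℕ
  multOf es a b = sum (map (λ e → ind (pairIs e a b)) es)

  multOf-∷ : ∀ a b es → 0 < multOf ((a , b) ∷ es) a b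
  multOf-∷ a b es = subst (λ i → 0 < ind i + multOf es a b) (sym (pairIs-refl a b)) (s≤s z≤n)

  ⟦_⟧ : List (Edge k) → MG k
  ⟦ es ⟧ = record
    { mult = multOf es
    ; sym = λ a b → cong sum (map-cong (λ e → cong ind (pairIs-sym e a b)) es) }

  ⟦⟧-++ : ∀ xs ys → ⟦ xs ++ ys ⟧ ≈ ⟦ xs ⟧ ⊎ᴹ ⟦ ys ⟧
  ⟦⟧-++ xs ys = pointwise λ a b → trans (cong sum (map-++ _ xs ys)) (sum-++ (map _ xs) _)

  ⟦⟧-∷ : ∀ e es → ⟦ e ∷ es ⟧ ≈ ⟦ e ∷ [] ⟧ ⊎ᴹ ⟦ es ⟧
  ⟦⟧-∷ e = ⟦⟧-++ (e ∷ [])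

  ⟦⟧-↭ : ∀ {xs ys} → xs ↭ ys → ⟦ xs ⟧ ≈ ⟦ ys ⟧
  ⟦⟧-↭ p = pointwise λ a b → sum-↭ (↭-map⁺ _ p)

  ⟦⟧-rotate : ∀ {A : Set} (f : List A → List (Edge k)) → (∀ xs ys → f (xs ++ ys) ≡ f xs ++ f ys) →
              ∀ xs ys → ⟦ f (xs ++ ys) ⟧ ≈ ⟦ f (ys ++ xs) ⟧
  ⟦⟧-rotate f f-++ xs ys rewrite f-++ xs ys | f-++ ys xs = ⟦⟧-↭ (++-comm (f xs) (f ys))

  flipEdges : List (Edge k) → List (Edge k)
  flipEdges es = reverse (map swap es)

  ⟦⟧-flipEdges : ∀ es → ⟦ flipEdges es ⟧ ≈ ⟦ es ⟧
  ⟦⟧-flipEdges es = pointwise λ a b → trans (at (⟦⟧-↭ (↭-reverse (map swap es))) a b)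
    (trans (cong sum (sym (map-∘ es))) (cong sum (map-cong (λ e → cong ind (pairIs-swap e a b)) es)))

  ⟦⟧-pairIs : ∀ c d u v → pairIs (c , d) u v ≡ true → ⟦ (c , d) ∷ [] ⟧ ≈ ⟦ (u , v) ∷ [] ⟧
  ⟦⟧-pairIs c d u v e with pairIs⇒≡ {c} {d} {u} {v} e
  ... | inj₁ (refl , refl) = ≈-refl
  ... | inj₂ (refl , refl) = pointwise λ a b → cong (λ i → ind i + 0) (pairIs-swap (d , c) a b)

  ⟦concatMap⟧-shift : ∀ {A : Set} (f : A → List (Edge k)) pre g post →
    ⟦ concatMap f (pre ++ g ∷ post) ⟧ ≈ ⟦ f g ⟧ ⊎ᴹ ⟦ concatMap f (pre ++ post) ⟧
  ⟦concatMap⟧-shift f pre g post = ≈-trans (⟦⟧-↭ (begin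
      concatMap f (pre ++ g ∷ post)                  ≡⟨ concatMap-++ f pre (g ∷ post) ⟩
      concatMap f pre ++ f g ++ concatMap f post     ↭⟨ shifts (concatMap f pre) (f g) ⟩
      f g ++ concatMap f pre ++ concatMap f post     ≡⟨ cong (f g ++_) (concatMap-++ f pre post) ⟨
      f g ++ concatMap f (pre ++ post)               ∎))
    (⟦⟧-++ (f g) _)
    where open PermutationReasoning

  -- The blue edges of the alternating walk from s to t whose red edges are es, in this order.
  gaps : Fin k → List (Edge k) → Fin k → List (Edge k)
  gaps s []             t = (s , t) ∷ []
  gaps s ((x , y) ∷ es) t = (s , x) ∷ gaps y es t

  gaps-++ : ∀ s xs x y ys t → gaps s (xs ++ (x , y) ∷ ys) t ≡ gaps s xs x ++ gaps y ys t
  gaps-++ s []               x y ys t = refl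
  gaps-++ s ((x′ , y′) ∷ xs) x y ys t = cong ((s , x′) ∷_) (gaps-++ y′ xs x y ys t)

  cycleGaps : List (Edge k) → List (Edge k)
  cycleGaps []             = []
  cycleGaps ((x , y) ∷ es) = gaps y es x

  cycleGaps-rotate : ∀ xs ys → cycleGaps (xs ++ ys) ↭ cycleGaps (ys ++ xs)
  cycleGaps-rotate [] ys rewrite ++-identityʳ ys = ↭-refl
  cycleGaps-rotate ((x , y) ∷ xs) [] rewrite ++-identityʳ xs = ↭-refl
  cycleGaps-rotate ((x , y) ∷ xs) ((x′ , y′) ∷ ys)
    rewrite gaps-++ y xs x′ y′ ys x | gaps-++ y′ ys x y xs x′ = ++-comm (gaps y xs x′) _

  gaps-flipEdges : ∀ s es t → gaps t (flipEdges es) s ≡ flipEdges (gaps s es t)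
  gaps-flipEdges s []             t = refl
  gaps-flipEdges s ((x , y) ∷ es) t = begin
    gaps t (flipEdges ((x , y) ∷ es)) s               ≡⟨ cong (λ zs → gaps t zs s) (unfold-reverse (y , x) (map swap es)) ⟩
    gaps t (flipEdges es ++ (y , x) ∷ []) s           ≡⟨ gaps-++ t (flipEdges es) y x [] s ⟩
    gaps t (flipEdges es) y ++ (x , s) ∷ []           ≡⟨ cong (_++ (x , s) ∷ []) (gaps-flipEdges y es t) ⟩
    flipEdges (gaps y es t) ++ (x , s) ∷ []           ≡⟨ unfold-reverse (x , s) (map swap (gaps y es t)) ⟨
    flipEdges ((s , x) ∷ gaps y es t)                 ∎
    where open ≡-Reasoning

  -- A red-blue Eulerian trail of R ⊎ B, recorded by its red edges in the order of traversal.
  record AltCycle (R B : MG k) : Set where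
    constructor altCycle
    field
      first  : Edge k
      others : List (Edge k)
      reds≈  : ⟦ first ∷ others ⟧ ≈ R
      blues≈ : ⟦ cycleGaps (first ∷ others) ⟧ ≈ B

  AltCycle-resp : ∀ {R R′ B B′} → R ≈ R′ → B ≈ B′ → AltCycle R B → AltCycle R′ B′
  AltCycle-resp R≈ B≈ (altCycle e es reds≈ blues≈) = altCycle e es (≈-trans reds≈ R≈) (≈-trans blues≈ B≈)

  -- Cutting a cycle at the edges of one summand

  _─_ : MG k → Edge k → MG k
  R ─ e = record
    { mult = λ a b → if pairIs e a b then pred (mult R a b) else mult R a b
    ; sym  = λ a b → cong₂ (λ c m → if c then pred m else m) (pairIs-sym e a b) (MG.sym R a b) }

  mult-pairIs : ∀ (R : MG k) {x y a b} → pairIs (x , y) a b ≡ true → mult R x y ≡ mult R a b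
  mult-pairIs R {x} {y} {a} {b} e with pairIs⇒≡ {x} {y} {a} {b} e
  ... | inj₁ (refl , refl) = refl
  ... | inj₂ (refl , refl) = MG.sym R _ _

  splitBy : MG k → List (Edge k) → List (Edge k ⊎ Edge k)
  splitBy R []             = []
  splitBy R ((x , y) ∷ es) with mult R x y
  ... | zero  = inj₂ (x , y) ∷ splitBy R es
  ... | suc _ = inj₁ (x , y) ∷ splitBy (R ─ (x , y)) es

  untag-splitBy : ∀ R es → map reduce (splitBy R es) ≡ es
  untag-splitBy R []             = refl
  untag-splitBy R ((x , y) ∷ es) with mult R x y
  ... | zero  = cong ((x , y) ∷_) (untag-splitBy R es)
  ... | suc _ = cong ((x , y) ∷_) (untag-splitBy (R ─ (x , y)) es)

  lefts-splitBy : ∀ R es a b → multOf (lefts (splitBy R es)) a b ≡ mult R a b ⊓ multOf es a b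
  lefts-splitBy R [] a b = sym (⊓-zeroʳ (mult R a b))
  lefts-splitBy R ((x , y) ∷ es) a b with mult R x y in Rxy
  ... | zero rewrite lefts-splitBy R es a b with pairIs (x , y) a b in e
  ...   | true  rewrite trans (sym (mult-pairIs R e)) Rxy = refl
  ...   | false = refl
  lefts-splitBy R ((x , y) ∷ es) a b | suc _
    rewrite lefts-splitBy (R ─ (x , y)) es a b with pairIs (x , y) a b in e
  ...   | true  rewrite trans (sym (mult-pairIs R e)) Rxy = refl
  ...   | false = refl

  ⟦untag⟧ : ∀ ts → ⟦ map reduce ts ⟧ ≈ ⟦ lefts ts ⟧ ⊎ᴹ ⟦ rights ts ⟧
  ⟦untag⟧ ts = pointwise (go ts)
    where
      go : ∀ ts a b → multOf (map reduce ts) a b ≡ multOf (lefts ts) a b + multOf (rights ts) a b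
      go []            a b = refl
      go (inj₁ e ∷ ts) a b = trans (cong (ind (pairIs e a b) +_) (go ts a b))
        (sym (+-assoc (ind (pairIs e a b)) (multOf (lefts ts) a b) (multOf (rights ts) a b)))
      go (inj₂ e ∷ ts) a b = trans (cong (ind (pairIs e a b) +_) (go ts a b))
        (ℕ+.x∙yz≈y∙xz (ind (pairIs e a b)) (multOf (lefts ts) a b) (multOf (rights ts) a b))

  splitBy-≈ : ∀ {R R′ es} → ⟦ es ⟧ ≈ R ⊎ᴹ R′ →
              ⟦ lefts (splitBy R es) ⟧ ≈ R × ⟦ rights (splitBy R es) ⟧ ≈ R′
  splitBy-≈ {R} {R′} {es} es≈ = lefts≈ , ⊎ᴹ-cancelˡ R (begin
      R ⊎ᴹ ⟦ rights ts ⟧                  ≈⟨ ⊎ᴹ-congʳ lefts≈ ⟨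
      ⟦ lefts ts ⟧ ⊎ᴹ ⟦ rights ts ⟧       ≈⟨ ⟦untag⟧ ts ⟨
      ⟦ map reduce ts ⟧                   ≡⟨ cong ⟦_⟧ (untag-splitBy R es) ⟩
      ⟦ es ⟧                              ≈⟨ es≈ ⟩
      R ⊎ᴹ R′                             ∎)
    where
      open SetoidReasoning ≈-setoid
      ts = splitBy R es
      lefts≈ : ⟦ lefts ts ⟧ ≈ R
      lefts≈ = pointwise λ a b → trans (lefts-splitBy R es a b)
        (trans (cong (mult R a b ⊓_) (at es≈ a b)) (m≤n⇒m⊓n≡m (m≤m+n _ _)))

  firstLeft : ∀ (ts : List (Edge k ⊎ Edge k)) → Nonempty ⟦ lefts ts ⟧ →
              ∃₂ λ pre post → ∃ λ e → ts ≡ pre ++ inj₁ e ∷ post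
  firstLeft []            (_ , _ , ())
  firstLeft (inj₁ e ∷ ts) _  = [] , ts , e , refl
  firstLeft (inj₂ e ∷ ts) ne with firstLeft ts ne
  ... | pre , post , e′ , refl = inj₂ e ∷ pre , post , e′ , refl

  -- The stretch of a cycle between two consecutive edges of the summand it is cut at: an
  -- alternating path from `from` to `to` whose red edges `reds` lie in the other summand.
  record Segment : Set where
    constructor segment
    field
      from : Fin k
      reds : List (Edge k)
      to   : Fin k

  shortcut : Segment → List (Edge k)
  shortcut g = (Segment.from g , Segment.to g) ∷ []

  segmentGaps : Segment → List (Edge k)
  segmentGaps g = gaps (Segment.from g) (Segment.reds g) (Segment.to g)

  segments : Fin k → List (Edge k) → List (Edge k ⊎ Edge k) → Fin k → List Segment
  segments s qs []                  t = segment s qs t ∷ []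
  segments s qs (inj₁ (x , y) ∷ ts) t = segment s qs x ∷ segments y [] ts t
  segments s qs (inj₂ e ∷ ts)       t = segments s (qs ++ e ∷ []) ts t

  shortcuts-segments : ∀ s qs ts t → concatMap shortcut (segments s qs ts t) ≡ gaps s (lefts ts) t
  shortcuts-segments s qs []                  t = refl
  shortcuts-segments s qs (inj₁ (x , y) ∷ ts) t = cong ((s , x) ∷_) (shortcuts-segments y [] ts t)
  shortcuts-segments s qs (inj₂ e ∷ ts)       t = shortcuts-segments s (qs ++ e ∷ []) ts t

  reds-segments : ∀ s qs ts t → concatMap Segment.reds (segments s qs ts t) ≡ qs ++ rights ts
  reds-segments s qs []                  t = refl
  reds-segments s qs (inj₁ (x , y) ∷ ts) t = cong (qs ++_) (reds-segments y [] ts t)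
  reds-segments s qs (inj₂ e ∷ ts)       t =
    trans (reds-segments s (qs ++ e ∷ []) ts t) (++-assoc qs (e ∷ []) (rights ts))

  gaps-segments : ∀ s qs ts t → concatMap segmentGaps (segments s qs ts t) ≡ gaps s (qs ++ map reduce ts) t
  gaps-segments s qs [] t = trans (++-identityʳ (gaps s qs t)) (cong (λ es → gaps s es t) (sym (++-identityʳ qs)))
  gaps-segments s qs (inj₁ (x , y) ∷ ts) t =
    trans (cong (gaps s qs x ++_) (gaps-segments y [] ts t)) (sym (gaps-++ s qs x y (map reduce ts) t))
  gaps-segments s qs (inj₂ e ∷ ts) t =
    trans (gaps-segments s (qs ++ e ∷ []) ts t) (cong (λ es → gaps s es t) (++-assoc qs (e ∷ []) (map reduce ts)))

  contractCycle : ∀ {R₁ R₂ M} → Nonempty R₁ → AltCycle (R₁ ⊎ᴹ R₂) M →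
    ∃ λ pool → AltCycle R₁ ⟦ concatMap shortcut pool ⟧
             × ⟦ concatMap Segment.reds pool ⟧ ≈ R₂
             × ⟦ concatMap segmentGaps pool ⟧ ≈ M
  contractCycle {R₁} {R₂} {M} ne (altCycle e₀ es reds≈ blues≈)
    with splitBy R₁ (e₀ ∷ es) | untag-splitBy R₁ (e₀ ∷ es) | splitBy-≈ {R₁} {R₂} {e₀ ∷ es} reds≈
  ... | ts | untag≡ | lefts≈ , rights≈ with firstLeft ts (Nonempty-resp (≈-sym lefts≈) ne)
  ... | pre , post , (x , y) , refl =
    pool , altCycle (x , y) (lefts rotated) lefts≈′ shortcuts≈ , rights≈′ , gaps≈
    where
      open SetoidReasoning ≈-setoid
      rotated = post ++ pre
      pool = segments y [] rotated x
      lefts≈′ : ⟦ (x , y) ∷ lefts rotated ⟧ ≈ R₁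
      lefts≈′ = ≈-trans (≈-sym (⟦⟧-rotate lefts (mapMaybe-++ _) pre (inj₁ (x , y) ∷ post))) lefts≈
      shortcuts≈ : ⟦ gaps y (lefts rotated) x ⟧ ≈ ⟦ concatMap shortcut pool ⟧
      shortcuts≈ = ≈-reflexive (cong ⟦_⟧ (sym (shortcuts-segments y [] rotated x)))
      rights≈′ : ⟦ concatMap Segment.reds pool ⟧ ≈ R₂
      rights≈′ = begin
        ⟦ concatMap Segment.reds pool ⟧             ≡⟨ cong ⟦_⟧ (reds-segments y [] rotated x) ⟩
        ⟦ rights (inj₁ (x , y) ∷ rotated) ⟧         ≈⟨ ⟦⟧-rotate rights (mapMaybe-++ _) pre (inj₁ (x , y) ∷ post) ⟨
        ⟦ rights (pre ++ inj₁ (x , y) ∷ post) ⟧     ≈⟨ rights≈ ⟩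
        R₂                                          ∎
      rotate-gaps : cycleGaps (map reduce (inj₁ (x , y) ∷ rotated)) ↭ cycleGaps (map reduce (pre ++ inj₁ (x , y) ∷ post))
      rotate-gaps rewrite map-++ reduce post pre | map-++ reduce pre (inj₁ (x , y) ∷ post) =
        cycleGaps-rotate ((x , y) ∷ map reduce post) (map reduce pre)
      gaps≈ : ⟦ concatMap segmentGaps pool ⟧ ≈ M
      gaps≈ = begin
        ⟦ concatMap segmentGaps pool ⟧                               ≡⟨ cong ⟦_⟧ (gaps-segments y [] rotated x) ⟩
        ⟦ cycleGaps (map reduce (inj₁ (x , y) ∷ rotated)) ⟧          ≈⟨ ⟦⟧-↭ rotate-gaps ⟩
        ⟦ cycleGaps (map reduce (pre ++ inj₁ (x , y) ∷ post)) ⟧      ≡⟨ cong (⟦_⟧ ∘ cycleGaps) untag≡ ⟩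
        ⟦ cycleGaps (e₀ ∷ es) ⟧                                      ≈⟨ blues≈ ⟩
        M                                                            ∎

  findSegment : ∀ pool {u v} → 0 < multOf (concatMap shortcut pool) u v →
    ∃₂ λ pre post → ∃ λ g → pool ≡ pre ++ g ∷ post × pairIs (Segment.from g , Segment.to g) u v ≡ true
  findSegment (g@(segment s _ t) ∷ pool) {u} {v} pos with pairIs (s , t) u v in e
  ... | true  = [] , pool , g , refl , e
  ... | false with findSegment pool pos
  ...   | pre , post , g′ , refl , e′ = g ∷ pre , post , g′ , refl , e′

  orient : ∀ g {u v} → pairIs (Segment.from g , Segment.to g) u v ≡ true →
           ∃ λ qs → ⟦ qs ⟧ ≈ ⟦ Segment.reds g ⟧ × ⟦ gaps u qs v ⟧ ≈ ⟦ segmentGaps g ⟧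
  orient (segment s qs t) {u} {v} e with pairIs⇒≡ {s} {t} {u} {v} e
  ... | inj₁ (refl , refl) = qs , ≈-refl , ≈-refl
  ... | inj₂ (refl , refl) = flipEdges qs , ⟦⟧-flipEdges qs , gaps≈
    where
      gaps≈ : ⟦ gaps t (flipEdges qs) s ⟧ ≈ ⟦ gaps s qs t ⟧
      gaps≈ rewrite gaps-flipEdges s qs t = ⟦⟧-flipEdges (gaps s qs t)

  noShortcuts : ∀ pool → ⟦ concatMap shortcut pool ⟧ ≈ ∅ → pool ≡ []
  noShortcuts []                      _  = refl
  noShortcuts (segment s _ t ∷ pool) eq with subst (0 <_) (at eq s t) (multOf-∷ s t (concatMap shortcut pool))
  ... | ()

  -- A segment of pool whose shortcut is {u, v}, reoriented to run from u to v, and the rest of pool.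
  record Taken (u v : Fin k) (es : List (Edge k)) (pool : List Segment) : Set where
    constructor taken
    field
      detour         : List (Edge k)
      rest           : List Segment
      rest-shortcuts : ⟦ es ⟧ ≈ ⟦ concatMap shortcut rest ⟧
      reds≈          : ⟦ concatMap Segment.reds pool ⟧ ≈ ⟦ detour ⟧ ⊎ᴹ ⟦ concatMap Segment.reds rest ⟧
      gaps≈          : ⟦ concatMap segmentGaps pool ⟧ ≈ ⟦ gaps u detour v ⟧ ⊎ᴹ ⟦ concatMap segmentGaps rest ⟧

  takeSegment : ∀ {u v es} pool → ⟦ (u , v) ∷ es ⟧ ≈ ⟦ concatMap shortcut pool ⟧ → Taken u v es pool
  takeSegment {u} {v} {es} pool eq
    with findSegment pool (subst (0 <_) (at eq u v) (multOf-∷ u v es))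
  ... | pre , post , g , refl , e with orient g e
  ... | qs , qs≈ , qs-gaps = taken qs (pre ++ post) rest-shortcuts
          (≈-trans (⟦concatMap⟧-shift Segment.reds pre g post) (⊎ᴹ-congʳ (≈-sym qs≈)))
          (≈-trans (⟦concatMap⟧-shift segmentGaps pre g post) (⊎ᴹ-congʳ (≈-sym qs-gaps)))
    where
      open SetoidReasoning ≈-setoid
      rest-shortcuts : ⟦ es ⟧ ≈ ⟦ concatMap shortcut (pre ++ post) ⟧
      rest-shortcuts = ⊎ᴹ-cancelˡ ⟦ (u , v) ∷ [] ⟧ (begin
        ⟦ (u , v) ∷ [] ⟧ ⊎ᴹ ⟦ es ⟧                                 ≈⟨ ⟦⟧-∷ (u , v) es ⟨
        ⟦ (u , v) ∷ es ⟧                                           ≈⟨ eq ⟩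
        ⟦ concatMap shortcut (pre ++ g ∷ post) ⟧                   ≈⟨ ⟦concatMap⟧-shift shortcut pre g post ⟩
        ⟦ shortcut g ⟧ ⊎ᴹ ⟦ concatMap shortcut (pre ++ post) ⟧     ≈⟨ ⊎ᴹ-congʳ (⟦⟧-pairIs (Segment.from g) (Segment.to g) u v e) ⟩
        ⟦ (u , v) ∷ [] ⟧ ⊎ᴹ ⟦ concatMap shortcut (pre ++ post) ⟧   ∎)

  expand : ∀ s ps t pool → ⟦ gaps s ps t ⟧ ≈ ⟦ concatMap shortcut pool ⟧ →
    ∃ λ es → ⟦ es ⟧ ≈ ⟦ ps ⟧ ⊎ᴹ ⟦ concatMap Segment.reds pool ⟧
           × ⟦ gaps s es t ⟧ ≈ ⟦ concatMap segmentGaps pool ⟧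
  expand s [] t pool eq with takeSegment pool eq
  ... | taken qs rest rest≈ reds≈ gaps≈ with noShortcuts rest (≈-sym rest≈)
  ... | refl = qs
              , ≈-sym (≈-trans (⊎ᴹ-identityˡ _) (≈-trans reds≈ (⊎ᴹ-identityʳ ⟦ qs ⟧)))
              , ≈-sym (≈-trans gaps≈ (⊎ᴹ-identityʳ _))
  expand s ((x , y) ∷ ps) t pool eq with takeSegment pool eq
  ... | taken qs rest rest≈ reds≈ gaps≈ with expand y ps t rest rest≈
  ... | es , es≈ , es-gaps = qs ++ (x , y) ∷ es , reds′ , gaps′
    where
      open SetoidReasoning ≈-setoid
      open ⊎ᴹ-Properties
      xy = (x , y) ∷ []
      reds′ : ⟦ qs ++ (x , y) ∷ es ⟧ ≈ ⟦ (x , y) ∷ ps ⟧ ⊎ᴹ ⟦ concatMap Segment.reds pool ⟧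
      reds′ = begin
        ⟦ qs ++ (x , y) ∷ es ⟧                        ≈⟨ ⟦⟧-++ qs _ ⟩
        ⟦ qs ⟧ ⊎ᴹ ⟦ (x , y) ∷ es ⟧                    ≈⟨ ⊎ᴹ-congˡ (≈-trans (⟦⟧-∷ (x , y) es) (⊎ᴹ-congˡ es≈)) ⟩
        ⟦ qs ⟧ ⊎ᴹ (⟦ xy ⟧ ⊎ᴹ (⟦ ps ⟧ ⊎ᴹ reds-rest))    ≈⟨ x∙yz≈y∙xz _ _ _ ⟩
        ⟦ xy ⟧ ⊎ᴹ (⟦ qs ⟧ ⊎ᴹ (⟦ ps ⟧ ⊎ᴹ reds-rest))    ≈⟨ ⊎ᴹ-congˡ (x∙yz≈y∙xz _ _ _) ⟩
        ⟦ xy ⟧ ⊎ᴹ (⟦ ps ⟧ ⊎ᴹ (⟦ qs ⟧ ⊎ᴹ reds-rest))    ≈⟨ ⊎ᴹ-assoc _ _ _ ⟨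
        (⟦ xy ⟧ ⊎ᴹ ⟦ ps ⟧) ⊎ᴹ (⟦ qs ⟧ ⊎ᴹ reds-rest)    ≈⟨ ⊎ᴹ-cong (⟦⟧-∷ (x , y) ps) reds≈ ⟨
        ⟦ (x , y) ∷ ps ⟧ ⊎ᴹ ⟦ concatMap Segment.reds pool ⟧ ∎
        where reds-rest = ⟦ concatMap Segment.reds rest ⟧
      gaps′ : ⟦ gaps s (qs ++ (x , y) ∷ es) t ⟧ ≈ ⟦ concatMap segmentGaps pool ⟧
      gaps′ = begin
        ⟦ gaps s (qs ++ (x , y) ∷ es) t ⟧                       ≡⟨ cong ⟦_⟧ (gaps-++ s qs x y es t) ⟩
        ⟦ gaps s qs x ++ gaps y es t ⟧                          ≈⟨ ⟦⟧-++ (gaps s qs x) _ ⟩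
        ⟦ gaps s qs x ⟧ ⊎ᴹ ⟦ gaps y es t ⟧                      ≈⟨ ⊎ᴹ-congˡ es-gaps ⟩
        ⟦ gaps s qs x ⟧ ⊎ᴹ ⟦ concatMap segmentGaps rest ⟧       ≈⟨ gaps≈ ⟨
        ⟦ concatMap segmentGaps pool ⟧                          ∎

  expandCycle : ∀ {A} pool → AltCycle A ⟦ concatMap shortcut pool ⟧ →
                AltCycle (A ⊎ᴹ ⟦ concatMap Segment.reds pool ⟧) ⟦ concatMap segmentGaps pool ⟧
  expandCycle {A} pool (altCycle (x , y) rs reds≈ blues≈) with expand y rs x pool blues≈
  ... | es , es≈ , es-gaps = altCycle (x , y) es (begin
        ⟦ (x , y) ∷ es ⟧                                              ≈⟨ ⟦⟧-∷ (x , y) es ⟩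
        ⟦ xy ⟧ ⊎ᴹ ⟦ es ⟧                                              ≈⟨ ⊎ᴹ-congˡ es≈ ⟩
        ⟦ xy ⟧ ⊎ᴹ (⟦ rs ⟧ ⊎ᴹ ⟦ concatMap Segment.reds pool ⟧)         ≈⟨ ⊎ᴹ-assoc _ _ _ ⟨
        (⟦ xy ⟧ ⊎ᴹ ⟦ rs ⟧) ⊎ᴹ ⟦ concatMap Segment.reds pool ⟧         ≈⟨ ⊎ᴹ-congʳ (≈-trans (≈-sym (⟦⟧-∷ (x , y) rs)) reds≈) ⟩
        A ⊎ᴹ ⟦ concatMap Segment.reds pool ⟧                          ∎) es-gaps
    where
      open SetoidReasoning ≈-setoid
      xy = (x , y) ∷ []

  Follows : Step k → Step k → Set
  Follows s s′ = tgt s ≡ src s′ × red? s ≢ red? s′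

  Chain : Step k → List (Step k) → Set
  Chain s []        = ⊤
  Chain s (s′ ∷ ss) = Follows s s′ × Chain s′ ss

  lastStep : Step k → List (Step k) → Step k
  lastStep s []        = s
  lastStep _ (s′ ∷ ss) = lastStep s′ ss

  Chain-snoc : ∀ s ss {s′} → Chain s ss → Follows (lastStep s ss) s′ → Chain s (ss ++ s′ ∷ [])
  Chain-snoc s []         _             f = f , tt
  Chain-snoc s (s″ ∷ ss) (f″ , chain) f = f″ , Chain-snoc s″ ss chain f

  lastStep-snoc : ∀ s ss s′ → lastStep s (ss ++ s′ ∷ []) ≡ s′
  lastStep-snoc s []         s′ = refl
  lastStep-snoc s (s″ ∷ ss) s′ = lastStep-snoc s″ ss s′

  coloured : Bool → List (Step k) → List (Edge k)
  coloured c []       = []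
  coloured c (s ∷ ss) = if ⌊ red? s Bool.≟ c ⌋ then (src s , tgt s) ∷ coloured c ss else coloured c ss

  coloured-++ : ∀ c xs ys → coloured c (xs ++ ys) ≡ coloured c xs ++ coloured c ys
  coloured-++ c []       ys = refl
  coloured-++ c (s ∷ xs) ys with ⌊ red? s Bool.≟ c ⌋
  ... | true  = cong ((src s , tgt s) ∷_) (coloured-++ c xs ys)
  ... | false = coloured-++ c xs ys

  record ClosedWalk (R B : MG k) : Set where
    constructor closedWalk
    field
      start  : Step k
      rest   : List (Step k)
      chain  : Chain start rest
      closes : Follows (lastStep start rest) start
      reds≈  : ⟦ coloured true (start ∷ rest) ⟧ ≈ R
      blues≈ : ⟦ coloured false (start ∷ rest) ⟧ ≈ B

  walkFrom : Fin k → List (Edge k) → Fin k → List (Step k)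
  walkFrom y []              z = step y z false ∷ []
  walkFrom y ((x , y′) ∷ es) z = step y x false ∷ step x y′ true ∷ walkFrom y′ es z

  reds-walkFrom : ∀ y es z → coloured true (walkFrom y es z) ≡ es
  reds-walkFrom y []              z = refl
  reds-walkFrom y ((x , y′) ∷ es) z = cong ((x , y′) ∷_) (reds-walkFrom y′ es z)

  blues-walkFrom : ∀ y es z → coloured false (walkFrom y es z) ≡ gaps y es z
  blues-walkFrom y []              z = refl
  blues-walkFrom y ((x , y′) ∷ es) z = cong ((y , x) ∷_) (blues-walkFrom y′ es z)

  walkFrom-chain : ∀ x y es z → Chain (step x y true) (walkFrom y es z)
  walkFrom-chain x y []              z = (refl , λ ()) , tt
  walkFrom-chain x y ((x′ , y′) ∷ es) z = (refl , λ ()) , (refl , λ ()) , walkFrom-chain x′ y′ es z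

  walkFrom-closes : ∀ s y es z w → Follows (lastStep s (walkFrom y es z)) (step z w true)
  walkFrom-closes s y []              z w = refl , λ ()
  walkFrom-closes s y ((x , y′) ∷ es) z w = walkFrom-closes (step x y′ true) y′ es z w

  chain⇒walkFrom : ∀ {x y z w} ss → Chain (step x y true) ss → Follows (lastStep (step x y true) ss) (step z w true) →
                   ss ≡ walkFrom y (coloured true ss) z
  chain⇒walkFrom []                                   _                    (_ , ne)   = ⊥-elim (ne refl)
  chain⇒walkFrom (step _ _ true ∷ _)                  ((_ , ne) , _)       _          = ⊥-elim (ne refl)
  chain⇒walkFrom (step _ _ false ∷ [])                ((refl , _) , _)     (refl , _) = refl
  chain⇒walkFrom (step _ _ false ∷ step _ _ false ∷ _) (_ , (_ , ne) , _)  _          = ⊥-elim (ne refl)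
  chain⇒walkFrom {z = z} {w} (step u v false ∷ step _ y′ true ∷ ss) ((refl , _) , (refl , _) , chain) closes =
    cong (λ ss′ → step u v false ∷ step v y′ true ∷ ss′) (chain⇒walkFrom {v} {y′} {z} {w} ss chain closes)

  AltCycle⇒ClosedWalk : ∀ {R B} → AltCycle R B → ClosedWalk R B
  AltCycle⇒ClosedWalk (altCycle (x , y) es reds≈ blues≈) =
    closedWalk (step x y true) (walkFrom y es x) (walkFrom-chain x y es x) (walkFrom-closes (step x y true) y es x y)
      (subst (λ rs → ⟦ (x , y) ∷ rs ⟧ ≈ _) (sym (reds-walkFrom y es x)) reds≈)
      (subst (λ bs → ⟦ bs ⟧ ≈ _) (sym (blues-walkFrom y es x)) blues≈)

  ClosedWalk⇒AltCycle : ∀ {R B} → ClosedWalk R B → AltCycle R B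
  ClosedWalk⇒AltCycle (closedWalk (step x y true) rest chain closes reds≈ blues≈) =
    altCycle (x , y) (coloured true rest) reds≈ (≈-trans (≈-reflexive (cong ⟦_⟧ blues≡)) blues≈)
    where
      blues≡ : gaps y (coloured true rest) x ≡ coloured false rest
      blues≡ = trans (sym (blues-walkFrom y (coloured true rest) x))
                     (cong (coloured false) (sym (chain⇒walkFrom {x} {y} {x} {y} rest chain closes)))
  ClosedWalk⇒AltCycle (closedWalk (step x y false) [] _ (_ , ne) _ _) = ⊥-elim (ne refl)
  ClosedWalk⇒AltCycle (closedWalk (step x y false) (step u v false ∷ _) ((_ , ne) , _) _ _ _) = ⊥-elim (ne refl)
  ClosedWalk⇒AltCycle (closedWalk (step x y false) (step u v true ∷ ss) (follows , chain) closes reds≈ blues≈) =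
    ClosedWalk⇒AltCycle (closedWalk (step u v true) (ss ++ step x y false ∷ [])
      (Chain-snoc (step u v true) ss {step x y false} chain closes)
      (subst (λ s → Follows s (step u v true)) (sym (lastStep-snoc (step u v true) ss (step x y false))) follows)
      (≈-trans (rotate true) reds≈) (≈-trans (rotate false) blues≈))
    where
      rotate : ∀ c → ⟦ coloured c ((step u v true ∷ ss) ++ step x y false ∷ []) ⟧
                   ≈ ⟦ coloured c (step x y false ∷ step u v true ∷ ss) ⟧
      rotate c = ⟦⟧-rotate (coloured c) (coloured-++ c) (step u v true ∷ ss) (step x y false ∷ [])

  uses-coloured : ∀ {m} (t : Fin m → Step k) c a b → uses t c a b ≡ multOf (coloured c (tabulate t)) a b
  uses-coloured {zero}  t c a b = refl
  uses-coloured {suc m} t c a b with ⌊ red? (t zero) Bool.≟ c ⌋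
  ... | true  = cong₂ _+_ (cong ind (∧-identityʳ _)) (uses-coloured (t ∘ suc) c a b)
  ... | false = cong₂ _+_ (cong ind (∧-zeroʳ _)) (uses-coloured (t ∘ suc) c a b)

  tabulate-chain : ∀ {m} (t : Fin (suc m) → Step k) → (∀ j → Follows (t (inject₁ j)) (t (suc j))) →
                   Chain (t zero) (tabulate (t ∘ suc))
  tabulate-chain {zero}  t f = tt
  tabulate-chain {suc m} t f = f zero , tabulate-chain (t ∘ suc) (f ∘ suc)

  lastStep-tabulate : ∀ {m} (t : Fin (suc m) → Step k) → lastStep (t zero) (tabulate (t ∘ suc)) ≡ t (fromℕ m)
  lastStep-tabulate {zero}  t = refl
  lastStep-tabulate {suc m} t = lastStep-tabulate (t ∘ suc)

  lookup-chain : ∀ s ss → Chain s ss → ∀ j → Follows (lookup (s ∷ ss) (inject₁ j)) (lookup (s ∷ ss) (suc j))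
  lookup-chain s (s′ ∷ ss) (f , _)     zero    = f
  lookup-chain s (s′ ∷ ss) (_ , chain) (suc j) = lookup-chain s′ ss chain j

  lookup-last : ∀ s ss → lookup (s ∷ ss) (fromℕ (length ss)) ≡ lastStep s ss
  lookup-last s []        = refl
  lookup-last s (s′ ∷ ss) = lookup-last s′ ss

  RBEulerian⇒ClosedWalk : ∀ {R B} → RBEulerian R B → ClosedWalk R B
  RBEulerian⇒ClosedWalk rb =
    closedWalk (t zero) (tabulate (t ∘ suc)) (tabulate-chain t follows-inject₁) closes
      (pointwise λ a b → trans (sym (uses-coloured t true a b)) (useRed a b))
      (pointwise λ a b → trans (sym (uses-coloured t false a b)) (useBlue a b))
    where
      open RBEulerian rb renaming (trail to t)
      follows : ∀ i → Follows (t i) (t (next i))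
      follows i = closed i , alt i
      follows-inject₁ : ∀ j → Follows (t (inject₁ j)) (t (suc j))
      follows-inject₁ j = subst (Follows (t (inject₁ j)) ∘ t) (next-inject₁ j) (follows (inject₁ j))
      closes : Follows (lastStep (t zero) (tabulate (t ∘ suc))) (t zero)
      closes = subst₂ Follows (sym (lastStep-tabulate t)) (cong t (next-fromℕ len)) (follows (fromℕ len))

  ClosedWalk⇒RBEulerian : ∀ {R B} → ClosedWalk R B → RBEulerian R B
  ClosedWalk⇒RBEulerian (closedWalk s ss chain closes reds≈ blues≈) = record
    { len     = length ss
    ; trail   = lookup (s ∷ ss)
    ; closed  = proj₁ ∘ follows
    ; alt     = proj₂ ∘ follows
    ; useRed  = λ a b → trans (uses-lookup true a b) (at reds≈ a b)
    ; useBlue = λ a b → trans (uses-lookup false a b) (at blues≈ a b) }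
    where
      follows : ∀ i → Follows (lookup (s ∷ ss) i) (lookup (s ∷ ss) (next i))
      follows i with inject₁-or-fromℕ i
      ... | inj₁ (j , refl) rewrite next-inject₁ j = lookup-chain s ss chain j
      ... | inj₂ refl rewrite next-fromℕ (length ss) | lookup-last s ss = closes
      uses-lookup : ∀ c a b → uses (lookup (s ∷ ss)) c a b ≡ multOf (coloured c (s ∷ ss)) a b
      uses-lookup c a b = trans (uses-coloured (lookup (s ∷ ss)) c a b)
                                (cong (λ xs → multOf (coloured c xs) a b) (tabulate-lookup (s ∷ ss)))

  RBEulerian⇒AltCycle : ∀ {R B} → RBEulerian R B → AltCycle R B
  RBEulerian⇒AltCycle = ClosedWalk⇒AltCycle ∘ RBEulerian⇒ClosedWalk

  AltCycle⇒RBEulerian : ∀ {R B} → AltCycle R B → RBEulerian R B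
  AltCycle⇒RBEulerian = ClosedWalk⇒RBEulerian ∘ AltCycle⇒ClosedWalk

  RBEulerian-resp : ∀ {R R′ B} → R ≈ R′ → RBEulerian R B → RBEulerian R′ B
  RBEulerian-resp R≈ rb = record
    { len = len ; trail = trail ; closed = closed ; alt = alt
    ; useRed = λ a b → trans (useRed a b) (at R≈ a b) ; useBlue = useBlue }
    where open RBEulerian rb

  ≲-replace : ∀ {𝒜 ℬ : Family k} {R₁ R₂ M} → 𝒜 ≲ ℬ → ℬ R₁ → Nonempty R₁ →
              RBEulerian (R₁ ⊎ᴹ R₂) M → ∃ λ A → 𝒜 A × RBEulerian (A ⊎ᴹ R₂) M
  ≲-replace 𝒜≲ℬ R₁∈ℬ R₁≠∅ trail with contractCycle R₁≠∅ (RBEulerian⇒AltCycle trail)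
  ... | pool , contracted , reds≈ , gaps≈
      with 𝒜≲ℬ ⟦ concatMap shortcut pool ⟧ (_ , R₁∈ℬ , AltCycle⇒RBEulerian contracted)
  ... | A , A∈𝒜 , trailA =
    A , A∈𝒜 , AltCycle⇒RBEulerian (AltCycle-resp (⊎ᴹ-congˡ reds≈) gaps≈ (expandCycle pool (RBEulerian⇒AltCycle trailA)))

  -- 𝒜 ≲ ℬ unfolds to a Π-type from which Agda cannot infer 𝒜 and ℬ, so calls name them.
  ≲-⊎ᴹ : ∀ {𝒜₁ ℬ₁ 𝒜₂ ℬ₂ : Family k} {B₁ B₂ M} → 𝒜₁ ≲ ℬ₁ → 𝒜₂ ≲ ℬ₂ →
         ℬ₁ B₁ → Nonempty B₁ → ℬ₂ B₂ → Nonempty B₂ → RBEulerian (B₁ ⊎ᴹ B₂) M →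
         ∃₂ λ A₁ A₂ → 𝒜₁ A₁ × 𝒜₂ A₂ × RBEulerian (A₁ ⊎ᴹ A₂) M
  ≲-⊎ᴹ {𝒜₁} {ℬ₁} {𝒜₂} {ℬ₂} {B₁} {B₂} {M} 𝒜₁≲ℬ₁ 𝒜₂≲ℬ₂ B₁∈ B₁≠∅ B₂∈ B₂≠∅ trail =
    let A₁ , A₁∈ , trail₁ = ≲-replace {𝒜 = 𝒜₁} {ℬ₁} {B₁} {B₂} {M} 𝒜₁≲ℬ₁ B₁∈ B₁≠∅ trail
        A₂ , A₂∈ , trail₂ = ≲-replace {𝒜 = 𝒜₂} {ℬ₂} {B₂} {A₁} {M} 𝒜₂≲ℬ₂ B₂∈ B₂≠∅
                                       (RBEulerian-resp (⊎ᴹ-comm A₁ B₂) trail₁)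
    in A₁ , A₂ , A₁∈ , A₂∈ , RBEulerian-resp (⊎ᴹ-comm A₂ A₁) trail₂

-- Path packings of a disjoint union

module _ {A : Set} where

  last-∷ : ∀ (x y : A) ys → last (x ∷ y ∷ ys) ≡ last (y ∷ ys)
  last-∷ x y ys with initLast ys
  ... | []      = refl
  ... | _ ∷ʳ′ _ = refl

module _ {A B : Set} where

  last-map : ∀ (f : A → B) x xs → last (List⁺.map f (x ∷ xs)) ≡ f (last (x ∷ xs))
  last-map f x []       = refl
  last-map f x (y ∷ ys) =
    trans (last-∷ (f x) (f y) (map f ys)) (trans (last-map f y ys) (cong f (sym (last-∷ x y ys))))

module _ {m : ℕ} where

  occ-++ : ∀ (v : Fin m) xs ys → occ v (xs ++ ys) ≡ occ v xs + occ v ys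
  occ-++ v []       ys = refl
  occ-++ v (w ∷ xs) ys =
    trans (cong (_ +_) (occ-++ v xs ys)) (sym (+-assoc (if ⌊ v ≟ w ⌋ then 1 else 0) (occ v xs) (occ v ys)))

  occ-↭ : ∀ (v : Fin m) {xs ys} → xs ↭ ys → occ v xs ≡ occ v ys
  occ-↭ v ↭.refl                      = refl
  occ-↭ v (↭.prep w p)                = cong (_ +_) (occ-↭ v p)
  occ-↭ v (↭.swap {xs} {ys} w u p)    =
    trans (ℕ+.x∙yz≈y∙xz (δ w) (δ u) (occ v xs)) (cong (λ o → δ u + (δ w + o)) (occ-↭ v p))
    where δ = λ w → if ⌊ v ≟ w ⌋ then 1 else 0
  occ-↭ v (↭.trans p q)               = trans (occ-↭ v p) (occ-↭ v q)

module _ {m m′ : ℕ} (f : Fin m → Fin m′) where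

  occ-map-injective : (∀ {i j} → f i ≡ f j → i ≡ j) → ∀ i xs → occ (f i) (map f xs) ≡ occ i xs
  occ-map-injective inj i []       = refl
  occ-map-injective inj i (w ∷ xs) with i ≟ w | f i ≟ f w
  ... | yes _    | yes _   = cong suc (occ-map-injective inj i xs)
  ... | yes refl | no fi≢  = ⊥-elim (fi≢ refl)
  ... | no i≢    | yes fi≡ = ⊥-elim (i≢ (inj fi≡))
  ... | no _     | no _    = occ-map-injective inj i xs

  occ-map-∉ : ∀ v → (∀ w → f w ≢ v) → ∀ xs → occ v (map f xs) ≡ 0
  occ-map-∉ v ∉ []       = refl
  occ-map-∉ v ∉ (w ∷ xs) with v ≟ f w
  ... | yes v≡ = ⊥-elim (∉ w (sym v≡))
  ... | no _   = occ-map-∉ v ∉ xs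

cat : ∀ {m} → List (List⁺ (Fin m)) → List (Fin m)
cat = concatMap List⁺.toList

Covers : ∀ {m} → List (Fin m) → Set
Covers xs = ∀ v → occ v xs ≡ 1

module _ {k : ℕ} where

  Choices : (H : LGraph k) → List (List⁺ (Fin (n H))) → Set
  Choices H = All (λ p → Σ (Edge k) (ValidChoice H p))

  auxMult-++ : ∀ {H : LGraph k} {xs ys} (φ : Choices H xs) (ψ : Choices H ys) a b →
               auxMult (All.++⁺ φ ψ) a b ≡ auxMult φ a b + auxMult ψ a b
  auxMult-++ []             ψ a b = refl
  auxMult-++ {H} ((e , _) ∷ φ) ψ a b =
    trans (cong (ind (pairIs e a b) +_) (auxMult-++ {H} φ ψ a b)) (sym (+-assoc (ind (pairIs e a b)) _ _))

  record ComponentEmbedding (G H : LGraph k) : Set where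
    field
      vertex     : Fin (n G) → Fin (n H)
      injective  : ∀ {u v} → vertex u ≡ vertex v → u ≡ v
      adj-vertex : ∀ u v → adj H (vertex u) (vertex v) ≡ adj G u v
      lab-vertex : ∀ u → lab H (vertex u) ≡ lab G u
      closed     : ∀ u v → adj H (vertex u) v ≡ true → ∃ λ w → v ≡ vertex w

  module _ {G H : LGraph k} (ι : ComponentEmbedding G H) where
    open ComponentEmbedding ι

    liftPath : List⁺ (Fin (n G)) → List⁺ (Fin (n H))
    liftPath = List⁺.map vertex

    Linked-lift : ∀ u us → Linked G u us → Linked H (vertex u) (map vertex us)
    Linked-lift u []       _        = tt
    Linked-lift u (v ∷ us) (uv , l) = trans (adj-vertex u v) uv , Linked-lift v us l

    IsPath-lift : ∀ {ps} → All (IsPath G) ps → All (IsPath H) (map liftPath ps)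
    IsPath-lift []               = []
    IsPath-lift {(u ∷ us) ∷ _} (l ∷ ls) = Linked-lift u us l ∷ IsPath-lift ls

    Linked-restrict : ∀ u us → Linked H (vertex u) us → ∃ λ us′ → us ≡ map vertex us′ × Linked G u us′
    Linked-restrict u []       _        = [] , refl , tt
    Linked-restrict u (v ∷ us) (uv , l) with closed u v uv
    ... | w , refl with Linked-restrict w us l
    ...   | us′ , refl , l′ = w ∷ us′ , refl , trans (sym (adj-vertex u w)) uv , l′

    ValidChoice-lift : ∀ p e → ValidChoice H (liftPath p) e ≡ ValidChoice G p e
    ValidChoice-lift (u ∷ us) (a , b)
      rewrite last-map vertex u us | lab-vertex u | lab-vertex (last (u ∷ us)) = refl

    liftChoices : ∀ {ps} → Choices G ps → Choices H (map liftPath ps)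
    liftChoices {[]}     []              = []
    liftChoices {p ∷ ps} ((e , valid) ∷ φ) = (e , subst id (sym (ValidChoice-lift p e)) valid) ∷ liftChoices φ

    auxMult-liftChoices : ∀ {ps} (φ : Choices G ps) a b → auxMult (liftChoices φ) a b ≡ auxMult φ a b
    auxMult-liftChoices []             a b = refl
    auxMult-liftChoices ((e , _) ∷ φ) a b = cong (ind (pairIs e a b) +_) (auxMult-liftChoices φ a b)

    cat-lift : ∀ ps → cat (map liftPath ps) ≡ map vertex (cat ps)
    cat-lift ps = trans (concatMap-map List⁺.toList liftPath ps) (sym (map-concatMap vertex List⁺.toList ps))

  module _ (H₁ H₂ : LGraph k) where
    private
      n₁ = n H₁
      n₂ = n H₂

    adj-⊕ : ∀ x y → adj (H₁ ⊕ H₂) (join n₁ n₂ x) (join n₁ n₂ y) ≡ adj⊕ (adj H₁) (adj H₂) x y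
    adj-⊕ x y rewrite splitAt-join n₁ n₂ x | splitAt-join n₁ n₂ y = refl

    lab-⊕ : ∀ x → lab (H₁ ⊕ H₂) (join n₁ n₂ x) ≡ [ lab H₁ , lab H₂ ]′ x
    lab-⊕ x rewrite splitAt-join n₁ n₂ x = refl

    ⊕-side : ∀ v → (∃ λ i → v ≡ i ↑ˡ n₂) ⊎ (∃ λ j → v ≡ n₁ ↑ʳ j)
    ⊕-side v with splitAt n₁ v | join-splitAt n₁ n₂ v
    ... | inj₁ i | eq = inj₁ (i , sym eq)
    ... | inj₂ j | eq = inj₂ (j , sym eq)

    ↑ˡ≢↑ʳ : ∀ i j → i ↑ˡ n₂ ≢ n₁ ↑ʳ j
    ↑ˡ≢↑ʳ i j eq with trans (sym (splitAt-↑ˡ n₁ i n₂)) (trans (cong (splitAt n₁) eq) (splitAt-↑ʳ n₁ n₂ j))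
    ... | ()

    inl : ComponentEmbedding H₁ (H₁ ⊕ H₂)
    inl = record
      { vertex     = _↑ˡ n₂
      ; injective  = ↑ˡ-injective n₂ _ _
      ; adj-vertex = λ u v → adj-⊕ (inj₁ u) (inj₁ v)
      ; lab-vertex = λ u → lab-⊕ (inj₁ u)
      ; closed     = closed }
      where
        closed : ∀ u v → adj (H₁ ⊕ H₂) (u ↑ˡ n₂) v ≡ true → ∃ λ w → v ≡ w ↑ˡ n₂
        closed u v uv with ⊕-side v
        ... | inj₁ side = side
        ... | inj₂ (j , refl) with trans (sym uv) (adj-⊕ (inj₁ u) (inj₂ j))
        ...   | ()

    inr : ComponentEmbedding H₂ (H₁ ⊕ H₂)
    inr = record
      { vertex     = n₁ ↑ʳ_
      ; injective  = ↑ʳ-injective n₁ _ _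
      ; adj-vertex = λ u v → adj-⊕ (inj₂ u) (inj₂ v)
      ; lab-vertex = λ u → lab-⊕ (inj₂ u)
      ; closed     = closed }
      where
        closed : ∀ u v → adj (H₁ ⊕ H₂) (n₁ ↑ʳ u) v ≡ true → ∃ λ w → v ≡ n₁ ↑ʳ w
        closed u v uv with ⊕-side v
        ... | inj₂ side = side
        ... | inj₁ (i , refl) with trans (sym uv) (adj-⊕ (inj₂ u) (inj₁ i))
        ...   | ()

    occ-inl : ∀ i X Y → occ (i ↑ˡ n₂) (map (_↑ˡ n₂) X ++ map (n₁ ↑ʳ_) Y) ≡ occ i X
    occ-inl i X Y = trans (occ-++ _ (map (_↑ˡ n₂) X) _)
      (trans (cong₂ _+_ (occ-map-injective _ (ComponentEmbedding.injective inl) i X)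
                        (occ-map-∉ _ _ (λ j eq → ↑ˡ≢↑ʳ i j (sym eq)) Y))
             (+-identityʳ (occ i X)))

    occ-inr : ∀ j X Y → occ (n₁ ↑ʳ j) (map (_↑ˡ n₂) X ++ map (n₁ ↑ʳ_) Y) ≡ occ j Y
    occ-inr j X Y = trans (occ-++ _ (map (_↑ˡ n₂) X) _)
      (cong₂ _+_ (occ-map-∉ _ _ (λ i eq → ↑ˡ≢↑ʳ i j eq) X) (occ-map-injective _ (ComponentEmbedding.injective inr) j Y))

    Covers-⊕ : ∀ {xs} X Y → xs ↭ map (_↑ˡ n₂) X ++ map (n₁ ↑ʳ_) Y → Covers xs ⇔ (Covers X × Covers Y)
    Covers-⊕ X Y xs↭ = mk⇔
      (λ covers → (λ i → trans (sym (occ-inl i X Y)) (trans (sym (occ-↭ _ xs↭)) (covers _)))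
                , (λ j → trans (sym (occ-inr j X Y)) (trans (sym (occ-↭ _ xs↭)) (covers _))))
      (λ (covers₁ , covers₂) v → trans (occ-↭ v xs↭) (covers-side v covers₁ covers₂))
      where
        covers-side : ∀ v → Covers X → Covers Y → occ v (map (_↑ˡ n₂) X ++ map (n₁ ↑ʳ_) Y) ≡ 1
        covers-side v covers₁ covers₂ with ⊕-side v
        ... | inj₁ (i , refl) = trans (occ-inl i X Y) (covers₁ i)
        ... | inj₂ (j , refl) = trans (occ-inr j X Y) (covers₂ j)

    InAux-⊕⁺ : ∀ {A₁ A₂} → InAux H₁ A₁ → InAux H₂ A₂ → InAux (H₁ ⊕ H₂) (A₁ ⊎ᴹ A₂)
    InAux-⊕⁺ {A₁} {A₂} (P₁ , φ₁ , aux₁) (P₂ , φ₂ , aux₂) = P , All.++⁺ (liftChoices inl φ₁) (liftChoices inr φ₂) , aux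
      where
        ps = map (liftPath inl) (paths P₁) ++ map (liftPath inr) (paths P₂)
        cat≡ : cat ps ≡ map (_↑ˡ n₂) (cat (paths P₁)) ++ map (n₁ ↑ʳ_) (cat (paths P₂))
        cat≡ = trans (concatMap-++ List⁺.toList (map (liftPath inl) (paths P₁)) _)
                     (cong₂ _++_ (cat-lift inl (paths P₁)) (cat-lift inr (paths P₂)))
        P : PathPacking (H₁ ⊕ H₂)
        P = record
          { paths   = ps
          ; arePath = All.++⁺ (IsPath-lift inl (arePath P₁)) (IsPath-lift inr (arePath P₂))
          ; cover   = Equivalence.from (Covers-⊕ (cat (paths P₁)) (cat (paths P₂)) (↭.↭-reflexive cat≡))
                                       (cover P₁ , cover P₂) }
        aux : auxOf (H₁ ⊕ H₂) P (All.++⁺ (liftChoices inl φ₁) (liftChoices inr φ₂)) ≋ (A₁ ⊎ᴹ A₂)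
        aux a b = trans (auxMult-++ {H₁ ⊕ H₂} (liftChoices inl φ₁) (liftChoices inr φ₂) a b)
          (cong₂ _+_ (trans (auxMult-liftChoices inl φ₁ a b) (aux₁ a b))
                     (trans (auxMult-liftChoices inr φ₂ a b) (aux₂ a b)))

    record Split (ps : List (List⁺ (Fin (n₁ + n₂)))) (φ : Choices (H₁ ⊕ H₂) ps) : Set where
      constructor split
      field
        ps₁    : List (List⁺ (Fin n₁))
        ps₂    : List (List⁺ (Fin n₂))
        paths₁ : All (IsPath H₁) ps₁
        paths₂ : All (IsPath H₂) ps₂
        φ₁     : Choices H₁ ps₁
        φ₂     : Choices H₂ ps₂
        cat↭   : cat ps ↭ map (_↑ˡ n₂) (cat ps₁) ++ map (n₁ ↑ʳ_) (cat ps₂)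
        aux≡   : ∀ a b → auxMult φ a b ≡ auxMult φ₁ a b + auxMult φ₂ a b

    consˡ : ∀ {ps φ} p → IsPath H₁ p → ∀ e (valid : ValidChoice (H₁ ⊕ H₂) (liftPath inl p) e) →
            Split ps φ → Split (liftPath inl p ∷ ps) ((e , valid) ∷ φ)
    consˡ {ps} p path e valid (split ps₁ ps₂ paths₁ paths₂ φ₁ φ₂ cat↭ aux≡) =
      split (p ∷ ps₁) ps₂ (path ∷ paths₁) paths₂ ((e , subst id (ValidChoice-lift inl p e) valid) ∷ φ₁) φ₂
        cat↭′ (λ a b → trans (cong (_ +_) (aux≡ a b)) (sym (+-assoc _ (auxMult φ₁ a b) (auxMult φ₂ a b))))
      where
        open PermutationReasoning
        ↑₁ = map (_↑ˡ n₂)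
        ↑₂ = map (n₁ ↑ʳ_)
        P = List⁺.toList p
        cat↭′ : ↑₁ P ++ cat ps ↭ ↑₁ (P ++ cat ps₁) ++ ↑₂ (cat ps₂)
        cat↭′ = begin
          ↑₁ P ++ cat ps                             ↭⟨ ++⁺ˡ (↑₁ P) cat↭ ⟩
          ↑₁ P ++ ↑₁ (cat ps₁) ++ ↑₂ (cat ps₂)       ≡⟨ ++-assoc (↑₁ P) (↑₁ (cat ps₁)) (↑₂ (cat ps₂)) ⟨
          (↑₁ P ++ ↑₁ (cat ps₁)) ++ ↑₂ (cat ps₂)     ≡⟨ cong (_++ ↑₂ (cat ps₂)) (map-++ _ P (cat ps₁)) ⟨
          ↑₁ (P ++ cat ps₁) ++ ↑₂ (cat ps₂)          ∎

    consʳ : ∀ {ps φ} p → IsPath H₂ p → ∀ e (valid : ValidChoice (H₁ ⊕ H₂) (liftPath inr p) e) →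
            Split ps φ → Split (liftPath inr p ∷ ps) ((e , valid) ∷ φ)
    consʳ {ps} p path e valid (split ps₁ ps₂ paths₁ paths₂ φ₁ φ₂ cat↭ aux≡) =
      split ps₁ (p ∷ ps₂) paths₁ (path ∷ paths₂) φ₁ ((e , subst id (ValidChoice-lift inr p e) valid) ∷ φ₂)
        cat↭′ (λ a b → trans (cong (_ +_) (aux≡ a b)) (ℕ+.x∙yz≈y∙xz _ (auxMult φ₁ a b) (auxMult φ₂ a b)))
      where
        open PermutationReasoning
        ↑₁ = map (_↑ˡ n₂)
        ↑₂ = map (n₁ ↑ʳ_)
        P = List⁺.toList p
        cat↭′ : ↑₂ P ++ cat ps ↭ ↑₁ (cat ps₁) ++ ↑₂ (P ++ cat ps₂)
        cat↭′ = begin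
          ↑₂ P ++ cat ps                             ↭⟨ ++⁺ˡ (↑₂ P) cat↭ ⟩
          ↑₂ P ++ ↑₁ (cat ps₁) ++ ↑₂ (cat ps₂)       ↭⟨ shifts (↑₂ P) (↑₁ (cat ps₁)) ⟩
          ↑₁ (cat ps₁) ++ ↑₂ P ++ ↑₂ (cat ps₂)       ≡⟨ cong (↑₁ (cat ps₁) ++_) (map-++ _ P (cat ps₂)) ⟨
          ↑₁ (cat ps₁) ++ ↑₂ (P ++ cat ps₂)          ∎

    splitPaths : ∀ ps → All (IsPath (H₁ ⊕ H₂)) ps → (φ : Choices (H₁ ⊕ H₂) ps) → Split ps φ
    splitPaths [] [] [] = split [] [] [] [] [] [] ↭-refl (λ _ _ → refl)
    splitPaths ((u ∷ us) ∷ ps) (path ∷ paths) ((e , valid) ∷ φ) with ⊕-side u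
    ... | inj₁ (i , refl) with Linked-restrict inl i us path
    ...   | us′ , refl , path′ = consˡ (i ∷ us′) path′ e valid (splitPaths ps paths φ)
    splitPaths ((u ∷ us) ∷ ps) (path ∷ paths) ((e , valid) ∷ φ) | inj₂ (j , refl) with Linked-restrict inr j us path
    ...   | us′ , refl , path′ = consʳ (j ∷ us′) path′ e valid (splitPaths ps paths φ)

    InAux-⊕⁻ : ∀ {B} → InAux (H₁ ⊕ H₂) B → ∃₂ λ B₁ B₂ → InAux H₁ B₁ × InAux H₂ B₂ × B ≈ B₁ ⊎ᴹ B₂
    InAux-⊕⁻ (P , φ , aux) with splitPaths (paths P) (arePath P) φ
    ... | split ps₁ ps₂ paths₁ paths₂ φ₁ φ₂ cat↭ aux≡ =
      auxOf H₁ P₁ φ₁ , auxOf H₂ P₂ φ₂ , (P₁ , φ₁ , λ _ _ → refl) , (P₂ , φ₂ , λ _ _ → refl) ,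
      pointwise λ a b → trans (sym (aux a b)) (aux≡ a b)
      where
        covers = Equivalence.to (Covers-⊕ (cat ps₁) (cat ps₂) cat↭) (cover P)
        P₁ : PathPacking H₁
        P₁ = record { paths = ps₁ ; arePath = paths₁ ; cover = proj₁ covers }
        P₂ : PathPacking H₂
        P₂ = record { paths = ps₂ ; arePath = paths₂ ; cover = proj₂ covers }

  InAux-resp : ∀ {H : LGraph k} {A A′} → A ≈ A′ → InAux H A → InAux H A′
  InAux-resp A≈ (P , φ , aux) = P , φ , λ a b → trans (aux a b) (at A≈ a b)

  InAux-nonempty : ∀ {H : LGraph k} {B} → n H ≥ 1 → InAux H B → Nonempty B
  InAux-nonempty {H} {B} n≥1 (P , φ , aux) =
    Nonempty-resp {A = auxOf H P φ} {B = B} (pointwise aux) (choices-nonempty φ (cover P (fromℕ< n≥1)))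
    where
      choices-nonempty : ∀ {ps v} (φ : Choices H ps) → occ v (cat ps) ≡ 1 → ∃₂ λ a b → 0 < auxMult φ a b
      choices-nonempty (((c , d) , _) ∷ φ) _ =
        c , d , subst (λ i → 0 < ind i + auxMult φ c d) (sym (pairIs-refl c d)) (s≤s z≤n)

mainTheorem8 : ∀ {k} (H₁ H₂ : LGraph k) → n H₁ ≥ 1 → n H₂ ≥ 1
    → (𝒜₁ 𝒜₂ : Family k)
    → 𝒜₁ ⊆ᶠ Aux H₁ → 𝒜₁ ≲ Aux H₁
    → 𝒜₂ ⊆ᶠ Aux H₂ → 𝒜₂ ≲ Aux H₂
    → (Combine 𝒜₁ 𝒜₂ ⊆ᶠ Aux (H₁ ⊕ H₂)) × (Combine 𝒜₁ 𝒜₂ ≲ Aux (H₁ ⊕ H₂))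
mainTheorem8 H₁ H₂ n₁≥1 n₂≥1 𝒜₁ 𝒜₂ 𝒜₁⊆ 𝒜₁≲ 𝒜₂⊆ 𝒜₂≲ = combine-⊆ , combine-≲
  where
    combine-⊆ : Combine 𝒜₁ 𝒜₂ ⊆ᶠ Aux (H₁ ⊕ H₂)
    combine-⊆ A (A₁ , A₂ , A₁∈ , A₂∈ , A≋) =
      InAux-resp {H = H₁ ⊕ H₂} {A₁ ⊎ᴹ A₂} {A} (≈-sym (pointwise A≋))
        (InAux-⊕⁺ H₁ H₂ {A₁} {A₂} (𝒜₁⊆ A₁ A₁∈) (𝒜₂⊆ A₂ A₂∈))

    combine-≲ : Combine 𝒜₁ 𝒜₂ ≲ Aux (H₁ ⊕ H₂)
    combine-≲ M (B , B∈ , trail) =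
      let B₁ , B₂ , B₁∈ , B₂∈ , B≈ = InAux-⊕⁻ H₁ H₂ B∈
          A₁ , A₂ , A₁∈ , A₂∈ , trail′ =
            ≲-⊎ᴹ {𝒜₁ = 𝒜₁} {Aux H₁} {𝒜₂} {Aux H₂} {B₁} {B₂} {M} 𝒜₁≲ 𝒜₂≲
                 B₁∈ (InAux-nonempty {H = H₁} {B₁} n₁≥1 B₁∈)
                 B₂∈ (InAux-nonempty {H = H₂} {B₂} n₂≥1 B₂∈)
                 (RBEulerian-resp B≈ trail)
      in A₁ ⊎ᴹ A₂ , (A₁ , A₂ , A₁∈ , A₂∈ , λ _ _ → refl) , trail′
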